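{- Let $\mathcal Z$ be a commutative associative unital $\mathbb Q$-algebra, $N\in\mathbb N$, $n\in[N]$, $Z=(z_{j,r})\in\mathcal Z^{N\times n}$. Let $R\subseteq[n]$ and $r\in[n]\setminus R$. Then $$\overline p_{R\cup\{r\}}-\widetilde z_r\,\overline p_R=-\frac1{2N}\sum_{s\in R}\sum_{j\in[N]^n_{\neq}}y_{j_r,j_s,r}\,y_{j_r,j_s,s}\,p_{j,R\setminus\{s\}}.$$
   Context: $[m]=\{1,\dots,m\}$. $[N]^n_{\neq}$ is the set of injective maps $j:[n]\to[N]$, written $(j_1,\dots,j_n)$. $\widetilde z_r=\frac1N\sum_{j=1}^Nz_{j,r}$, $y_{j,k,r}=z_{j,r}-z_{k,r}$. For $R\subseteq[n]$ and $j\in[N]^n_{\neq}$, $p_{j,R}=\prod_{\ell\in R}z_{j_\ell,\ell}$, and $\overline p_R=\sum_{j\in[N]^n_{\neq}}p_{j,R}$. Empty sums are $0$, empty products are $1$. -}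

module Defs where

open import Level using (Level; _⊔_)
open import Function using (_∘_)
open import Data.Bool using (Bool; true; false; if_then_else_)
open import Data.Nat using (ℕ; zero; suc)
open import Data.Integer using (+_)
open import Data.Fin using (Fin; _≟_)
import Data.Fin as F
open import Data.Fin.Properties using (all?)
open import Data.Fin.Subset using (Subset)
open import Data.List using (List; []; _∷_; map; concatMap; filter; allFin)
open import Data.Vec using (lookup)
import Data.Vec
open import Relation.Binary.PropositionalEquality using (_≡_)
import Data.Vec.Functional as VF
open import Data.Rational using (ℚ; 0ℚ; _/_)
import Data.Rational.Properties as ℚP
open import Relation.Nullary.Decidable using (Dec; _→-dec_)
open import Algebra.Bundles using (CommutativeRing)
open import Algebra.Morphism.Structures using (module RingMorphisms)

record QAlgebra (c ℓ : Level) : Set (Level.suc (c ⊔ ℓ)) where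
  field
    commRing : CommutativeRing c ℓ
  open CommutativeRing commRing public
  field
    ι : ℚ → Carrier
    ι-isRingHomomorphism :
      RingMorphisms.IsRingHomomorphism ℚP.+-*-rawRing rawRing ι

-- 1/m as a rational number (only used for m ≥ 1; the value at 0 is irrelevant).
recip : ℕ → ℚ
recip zero    = 0ℚ
recip (suc k) = + 1 / suc k

allMaps : (n N : ℕ) → List (Fin n → Fin N)
allMaps zero    N = (λ ()) ∷ []
allMaps (suc n) N =
  concatMap (λ f → map (λ i → i VF.∷ f) (allFin N)) (allMaps n N)

injective? : ∀ {n N} (f : Fin n → Fin N) → Dec (∀ x y → f x ≡ f y → x ≡ y)
injective? f = all? (λ x → all? (λ y → (f x ≟ f y) →-dec (x ≟ y)))

injMaps : (n N : ℕ) → List (Fin n → Fin N)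
injMaps n N = filter injective? (allMaps n N)

module _ {c ℓ} (𝓩 : QAlgebra c ℓ) where
  open QAlgebra 𝓩

  Σ-list : ∀ {a} {A : Set a} → List A → (A → Carrier) → Carrier
  Σ-list []       f = 0#
  Σ-list (x ∷ xs) f = f x + Σ-list xs f

  Σ-Fin : ∀ {n} → (Fin n → Carrier) → Carrier
  Σ-Fin {zero}  f = 0#
  Σ-Fin {suc n} f = f F.zero + Σ-Fin (f ∘ F.suc)

  Σ-sub : ∀ {n} → Subset n → (Fin n → Carrier) → Carrier
  Σ-sub R f = Σ-Fin (λ s → if lookup R s then f s else 0#)

  Π-sub : ∀ {n} → Subset n → (Fin n → Carrier) → Carrier
  Π-sub {zero}  R f = 1#
  Π-sub {suc n} R f =
    (if lookup R F.zero then f F.zero else 1#) * Π-sub (Data.Vec.tail R) (f ∘ F.suc)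

  Σ-inj : ∀ {n N} → ((Fin n → Fin N) → Carrier) → Carrier
  Σ-inj {n} {N} f = Σ-list (injMaps n N) f

  module _ {N n : ℕ} (Z : Fin N → Fin n → Carrier) where
    z̃ : Fin n → Carrier
    z̃ r = ι (recip N) * Σ-Fin (λ j → Z j r)

    y : Fin N → Fin N → Fin n → Carrier
    y j k r = Z j r - Z k r

    p : (Fin n → Fin N) → Subset n → Carrier
    p j R = Π-sub R (λ l → Z (j l) l)

    p̄ : Subset n → Carrier
    p̄ R = Σ-inj (λ j → p j R)

-- Write w̄_t = Σ_{j ∈ [N]^n_≠} z_{j_t,r} p_{j,R}, so that w̄_r = p̄_{R∪{r}}. For injective j the
-- sum Σ_k z_{k,r} splits into the n values z_{j_t,r} and the N − n values at k ∉ im j, whence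
-- N z̃_r p̄_R = Σ_t w̄_t + (N − n) w̄_r: relabelling j by the transposition (t r) gives w̄_t = w̄_r
-- for t ∉ R, and every injective j has exactly N − n injective extensions to [n+1]. On the other
-- side, expanding y y p_{R∖s} and relabelling by (r s) gives Σ_j y y p_{R∖s} = 2 (w̄_s − w̄_r) for
-- s ∈ R. Both sides of the identity therefore equal −(1/N) Σ_{s∈R} (w̄_s − w̄_r).

module Submission where

open import Defs
open import Data.Nat using (ℕ; zero; suc; _≤_)
import Data.Nat as ℕ
import Data.Nat.Properties as ℕP
open import Data.Nat.Coprimality using (1-coprimeTo)
import Data.Nat.Coprimality as Coprime
import Data.Integer as ℤ
open import Data.Integer.Tactic.RingSolver using (solve-∀)
open import Data.Rational using (ℚ; mkℚ; 1ℚ)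
import Data.Rational as ℚ
import Data.Rational.Properties as ℚP
import Data.Rational.Unnormalised as ℚᵘ
open import Data.Rational.Unnormalised.Properties using (≃-trans)
open import Data.Fin using (Fin; zero; suc; _≟_)
open import Data.Fin.Properties using (all?; suc-injective; 0≢1+n)
open import Data.Fin.Permutation using (lift₀-transpose)
open import Data.Fin.Permutation.Components using (transpose; transpose-inverse)
open import Data.Fin.Subset using (Subset; _∈_; _∉_; _∪_; ⁅_⁆; ∁)
import Data.Fin.Subset as Sub
open import Data.Fin.Subset.Properties using (∪-identityʳ; p─⊥≡p; p─q⊆p; x∈∁p⇒x∉p)
open import Data.Bool using (Bool; true; false; if_then_else_; not; _∧_)
open import Data.List using (List; []; _∷_; _++_; map; concatMap; filter; allFin; tabulate)
open import Data.Vec using ([]; _∷_; lookup; here; there)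
open import Data.Vec.Properties using (lookup⇒[]=; lookup-map)
open import Data.Vec.Functional using () renaming (_∷_ to _∷ᶠ_)
open import Data.Maybe using (Maybe)
import Data.Maybe as Maybe
open import Data.Empty using (⊥-elim)
open import Data.Product using (_,_)
import Data.Product as Product
open import Function using (id; _∘_; _⇔_; mk⇔)
open import Relation.Nullary using (Dec; yes; no; does; ¬?; _×-dec_)
open import Relation.Nullary.Decidable using (does-⇔; dec-true; dec-false; dec⇒maybe)
open import Relation.Unary using (Pred; Decidable)
open import Relation.Binary.PropositionalEquality as ≡ using (_≡_; _≢_; _≗_; ≢-sym)
open import Algebra.Morphism.Structures using (module RingMorphisms)
open import Algebra.Solver.Ring.AlmostCommutativeRing using (AlmostCommutativeRing; fromCommutativeRing; _-Raw-AlmostCommutative⟶_)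
import Algebra.Solver.Ring as RingSolver
import Algebra.Properties.Monoid.Mult ℚP.+-0-monoid as ℚMult

ℕ→ℚ : ℕ → ℚ
ℕ→ℚ k = mkℚ (ℤ.+ k) 0 (Coprime.sym (1-coprimeTo k))

suc×1ℚ≡ℕ→ℚ : ∀ k → suc k ℚMult.× 1ℚ ≡ ℕ→ℚ (suc k)
suc×1ℚ≡ℕ→ℚ zero    = ℚP.+-identityʳ 1ℚ
suc×1ℚ≡ℕ→ℚ (suc k) = ≡.trans (≡.cong (λ q → 1ℚ ℚ.+ q) (suc×1ℚ≡ℕ→ℚ k))
  (ℚP.toℚᵘ-injective (≃-trans (ℚP.toℚᵘ-homo-+ 1ℚ (ℕ→ℚ (suc k))) (ℚᵘ.*≡* (cross-multiplied (ℤ.+ k)))))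
  where
  cross-multiplied : ∀ m →
    (ℤ.1ℤ ℤ.* ℤ.1ℤ ℤ.+ (ℤ.1ℤ ℤ.+ m) ℤ.* ℤ.1ℤ) ℤ.* ℤ.1ℤ ≡ (ℤ.1ℤ ℤ.+ (ℤ.1ℤ ℤ.+ m)) ℤ.* (ℤ.1ℤ ℤ.* ℤ.1ℤ)
  cross-multiplied = solve-∀

recip-inverseˡ : ∀ k → recip (suc k) ℚ.* (suc k ℚMult.× 1ℚ) ≡ 1ℚ
recip-inverseˡ k =
  ≡.trans (≡.cong₂ ℚ._*_ (ℚP.normalize-coprime (1-coprimeTo (suc k))) (suc×1ℚ≡ℕ→ℚ k))
          (ℚP.*-inverseˡ (ℕ→ℚ (suc k)))

-- Transpositions and injective maps

module _ {n : ℕ} where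

  transpose-matchˡ : ∀ (i j : Fin n) → transpose i j i ≡ j
  transpose-matchˡ i j rewrite dec-true (i ≟ i) ≡.refl = ≡.refl

  transpose-matchʳ : ∀ (i j : Fin n) → transpose i j j ≡ i
  transpose-matchʳ i j with j ≟ i
  ... | yes j≡i = j≡i
  ... | no  _   rewrite dec-true (j ≟ j) ≡.refl = ≡.refl

  transpose-other : ∀ (i j : Fin n) {k} → k ≢ i → k ≢ j → transpose i j k ≡ k
  transpose-other i j {k} k≢i k≢j rewrite dec-false (k ≟ i) k≢i | dec-false (k ≟ j) k≢j = ≡.refl

  transpose-unique : ∀ (i j : Fin n) (σ : Fin n → Fin n) → σ i ≡ j → σ j ≡ i →
    (∀ k → k ≢ i → k ≢ j → σ k ≡ k) → σ ≗ transpose i j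
  transpose-unique i j σ σi σj σk k = by-cases (k ≟ i) (k ≟ j)
    where
    by-cases : Dec (k ≡ i) → Dec (k ≡ j) → σ k ≡ transpose i j k
    by-cases (yes ≡.refl) _            = ≡.trans σi (≡.sym (transpose-matchˡ i j))
    by-cases (no _)       (yes ≡.refl) = ≡.trans σj (≡.sym (transpose-matchʳ i j))
    by-cases (no k≢i)     (no k≢j)     = ≡.trans (σk k k≢i k≢j) (≡.sym (transpose-other i j k≢i k≢j))

  transpose-comm : ∀ (i j : Fin n) → transpose j i ≗ transpose i j
  transpose-comm i j = transpose-unique i j (transpose j i) (transpose-matchʳ j i) (transpose-matchˡ j i)
    (λ k k≢i k≢j → transpose-other j i k≢j k≢i)

  transpose-involutive : ∀ (i j : Fin n) k → transpose i j (transpose i j k) ≡ k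
  transpose-involutive i j k = ≡.trans (≡.cong (transpose i j) (≡.sym (transpose-comm i j k))) (transpose-inverse i j)

  transpose-self : ∀ (i : Fin n) → transpose i i ≗ id
  transpose-self i k = ≡.sym (transpose-unique i i id ≡.refl ≡.refl (λ _ _ _ → ≡.refl) k)

  transpose-conjugate : ∀ {i j k : Fin n} → i ≢ j → j ≢ k → i ≢ k →
    transpose j k ∘ transpose i j ∘ transpose j k ≗ transpose i k
  transpose-conjugate {i} {j} {k} i≢j j≢k i≢k = transpose-unique i k _ at-i at-k elsewhere
    where
    at-i : transpose j k (transpose i j (transpose j k i)) ≡ k
    at-i rewrite transpose-other j k i≢j i≢k | transpose-matchˡ i j = transpose-matchˡ j k
    at-k : transpose j k (transpose i j (transpose j k k)) ≡ i
    at-k rewrite transpose-matchʳ j k | transpose-matchʳ i j = transpose-other j k i≢j i≢k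
    elsewhere : ∀ l → l ≢ i → l ≢ k → transpose j k (transpose i j (transpose j k l)) ≡ l
    elsewhere l l≢i l≢k = by-cases (l ≟ j)
      where
      by-cases : Dec (l ≡ j) → transpose j k (transpose i j (transpose j k l)) ≡ l
      by-cases (yes ≡.refl) = ≡.trans (≡.cong (transpose l k ∘ transpose i l) (transpose-matchˡ l k))
        (≡.trans (≡.cong (transpose l k) (transpose-other i l (≢-sym i≢k) (≢-sym j≢k))) (transpose-matchʳ l k))
      by-cases (no l≢j)     = ≡.trans (≡.cong (transpose j k ∘ transpose i j) (transpose-other j k l≢j l≢k))
        (≡.trans (≡.cong (transpose j k) (transpose-other i j l≢i l≢j)) (transpose-other j k l≢j l≢k))

module _ {A : Set} where

  ∷ᶠ-cong : ∀ {n} (x : A) {f f' : Fin n → A} → f ≗ f' → x ∷ᶠ f ≗ x ∷ᶠ f'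
  ∷ᶠ-cong x f≗f' zero    = ≡.refl
  ∷ᶠ-cong x f≗f' (suc k) = f≗f' k

  ∷ᶠ-∘-transpose : ∀ {n} (x : A) (f : Fin n → A) (a b : Fin n) →
    x ∷ᶠ (f ∘ transpose a b) ≗ (x ∷ᶠ f) ∘ transpose (suc a) (suc b)
  ∷ᶠ-∘-transpose x f a b zero    = ≡.refl
  ∷ᶠ-∘-transpose x f a b (suc k) = ≡.sym (≡.cong (x ∷ᶠ f) (lift₀-transpose a b (suc k)))

  ∷ᶠ-∷ᶠ-transpose : ∀ {n} (x y : A) (f : Fin n → A) →
    x ∷ᶠ y ∷ᶠ f ≗ (y ∷ᶠ x ∷ᶠ f) ∘ transpose zero (suc zero)
  ∷ᶠ-∷ᶠ-transpose x y f zero          = ≡.refl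
  ∷ᶠ-∷ᶠ-transpose x y f (suc zero)    = ≡.refl
  ∷ᶠ-∷ᶠ-transpose x y f (suc (suc k)) = ≡.refl

module _ {n N : ℕ} where

  IsInjective : (Fin n → Fin N) → Set
  IsInjective f = ∀ x y → f x ≡ f y → x ≡ y

  Fresh : Fin N → (Fin n → Fin N) → Set
  Fresh i f = ∀ t → f t ≢ i

  fresh? : ∀ i f → Dec (Fresh i f)
  fresh? i f = all? (λ t → ¬? (f t ≟ i))

  injective-resp-≗ : ∀ {f g : Fin n → Fin N} → f ≗ g → IsInjective f → IsInjective g
  injective-resp-≗ f≗g inj x y gx≡gy = inj x y (≡.trans (f≗g x) (≡.trans gx≡gy (≡.sym (f≗g y))))

  injective-∘-involution : ∀ (σ : Fin n → Fin n) → (∀ k → σ (σ k) ≡ k) →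
    (j : Fin n → Fin N) → IsInjective (j ∘ σ) ⇔ IsInjective j
  injective-∘-involution σ σσ≗id j = mk⇔
    (λ inj x y jx≡jy → ≡.trans (≡.sym (σσ≗id x)) (≡.trans (≡.cong σ
       (inj (σ x) (σ y) (≡.trans (≡.cong j (σσ≗id x)) (≡.trans jx≡jy (≡.cong j (≡.sym (σσ≗id y)))))))
       (σσ≗id y)))
    (λ inj x y jσx≡jσy → ≡.trans (≡.sym (σσ≗id x)) (≡.trans (≡.cong σ (inj _ _ jσx≡jσy)) (σσ≗id y)))

injective-∷ : ∀ {n N} (i : Fin N) (f : Fin n → Fin N) →
  IsInjective (i ∷ᶠ f) ⇔ (IsInjective f Product.× Fresh i f)
injective-∷ i f = mk⇔
  (λ inj → (λ x y fx≡fy → suc-injective (inj (suc x) (suc y) fx≡fy)) , (λ t ft≡i → 0≢1+n (inj zero (suc t) (≡.sym ft≡i))))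
  (λ (inj , fresh) → λ where
    zero    zero    _     → ≡.refl
    zero    (suc y) i≡fy  → ⊥-elim (fresh y (≡.sym i≡fy))
    (suc x) zero    fx≡i  → ⊥-elim (fresh x fx≡i)
    (suc x) (suc y) fx≡fy → ≡.cong suc (inj x y fx≡fy))

module _ {c ℓ} (𝓩 : QAlgebra c ℓ) where
  open QAlgebra 𝓩 hiding (zero)
  open RingMorphisms.IsRingHomomorphism ι-isRingHomomorphism
    using (+-homo; *-homo; -‿homo; 0#-homo; 1#-homo)
  open import Algebra.Properties.Semiring.Sum semiring
    using (sum; sum-cong-≋; sum-cong-≗; ∑-distrib-+; ∑-comm; *-distribʳ-sum; sum-replicate; sum-replicate-zero)
  open import Algebra.Properties.Semiring.Mult semiring using (_×_; ×-congʳ; ×-congˡ; ×-homo-+; ×-assoc-*)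
  open import Algebra.Properties.CommutativeSemigroup +-commutativeSemigroup
    using () renaming (interchange to +-interchange)
  open import Algebra.Properties.CommutativeSemigroup *-commutativeSemigroup
    using () renaming (x∙yz≈y∙xz to x*yz≈y*xz)
  open import Relation.Binary.Reasoning.Setoid setoid

  private
    acr : AlmostCommutativeRing c ℓ
    acr = fromCommutativeRing commRing
    ι-morphism : ℚP.+-*-rawRing -Raw-AlmostCommutative⟶ acr
    ι-morphism = record
      { ⟦_⟧ = ι ; +-homo = +-homo ; *-homo = *-homo ; -‿homo = -‿homo ; 0-homo = 0#-homo ; 1-homo = 1#-homo }
    ι-equal? : ∀ p q → Maybe (ι p ≈ ι q)
    ι-equal? p q = Maybe.map (reflexive ∘ ≡.cong ι) (dec⇒maybe (p ℚP.≟ q))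
    module Solver = RingSolver ℚP.+-*-rawRing acr ι-morphism ι-equal?
  open Solver using (solve; _:+_; _:*_; _:-_; :-_; _:=_)

  -- Numerals and finite sums in a ℚ-algebra

  ι-homo-× : ∀ m q → ι (m ℚMult.× q) ≈ m × ι q
  ι-homo-× zero    q = 0#-homo
  ι-homo-× (suc m) q = trans (+-homo q (m ℚMult.× q)) (+-cong refl (ι-homo-× m q))

  recip-×-cancel : ∀ k x → ι (recip (suc k)) * (suc k × x) ≈ x
  recip-×-cancel k x = begin
    ι (recip (suc k)) * (suc k × x)              ≈⟨ *-cong refl (trans (×-assoc-* (suc k) 1# x) (×-congʳ (suc k) (*-identityˡ x))) ⟨
    ι (recip (suc k)) * ((suc k × 1#) * x)       ≈⟨ *-assoc _ _ x ⟨
    ι (recip (suc k)) * (suc k × 1#) * x         ≈⟨ *-cong (*-cong refl (trans (ι-homo-× (suc k) 1ℚ) (×-congʳ (suc k) 1#-homo))) refl ⟨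
    ι (recip (suc k)) * ι (suc k ℚMult.× 1ℚ) * x ≈⟨ *-cong (*-homo _ _) refl ⟨
    ι (recip (suc k) ℚ.* (suc k ℚMult.× 1ℚ)) * x ≈⟨ *-cong (reflexive (≡.cong ι (recip-inverseˡ k))) refl ⟩
    ι 1ℚ * x                                     ≈⟨ *-cong 1#-homo refl ⟩
    1# * x                                       ≈⟨ *-identityˡ x ⟩
    x                                            ∎

  recip-double : ∀ k → ι (recip (2 ℕ.* suc k)) + ι (recip (2 ℕ.* suc k)) ≈ ι (recip (suc k))
  recip-double k = begin
    d + d                        ≈⟨ +-cong (*-identityʳ d) (*-identityʳ d) ⟨
    d * 1# + d * 1#              ≈⟨ distribˡ d 1# 1# ⟨
    d * (1# + 1#)                ≈⟨ *-identityʳ _ ⟨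
    d * (1# + 1#) * 1#           ≈⟨ *-cong refl (recip-×-cancel k 1#) ⟨
    d * (1# + 1#) * (r * u)      ≈⟨ rearrange d (1# + 1#) r u ⟩
    r * (d * ((1# + 1#) * u))    ≈⟨ *-cong refl (*-cong refl double) ⟨
    r * (d * ((2 ℕ.* suc k) × 1#)) ≈⟨ *-cong refl (recip-×-cancel (k ℕ.+ suc (k ℕ.+ 0)) 1#) ⟩
    r * 1#                       ≈⟨ *-identityʳ r ⟩
    r                            ∎
    where
    r d u : Carrier
    r = ι (recip (suc k))
    d = ι (recip (2 ℕ.* suc k))
    u = suc k × 1#
    rearrange : ∀ a b e u → a * b * (e * u) ≈ e * (a * (b * u))
    rearrange = solve 4 (λ a b e u → a :* b :* (e :* u) := e :* (a :* (b :* u))) refl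
    double : (2 ℕ.* suc k) × 1# ≈ (1# + 1#) * u
    double = begin
      (2 ℕ.* suc k) × 1#                ≈⟨ ×-homo-+ 1# (suc k) (suc k ℕ.+ 0) ⟩
      u + (suc k ℕ.+ 0) × 1#           ≈⟨ +-cong refl (×-congˡ (ℕP.+-identityʳ (suc k))) ⟩
      u + u                            ≈⟨ +-cong (*-identityˡ u) (*-identityˡ u) ⟨
      1# * u + 1# * u                  ≈⟨ distribʳ u 1# 1# ⟨
      (1# + 1#) * u                    ∎

  Σ-Fin≡sum : ∀ {n} (f : Fin n → Carrier) → Σ-Fin 𝓩 f ≡ sum f
  Σ-Fin≡sum {zero}  f = ≡.refl
  Σ-Fin≡sum {suc n} f = ≡.cong (f zero +_) (Σ-Fin≡sum (f ∘ suc))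

  Σ-Fin-cong : ∀ {n} {f g : Fin n → Carrier} → (∀ i → f i ≈ g i) → Σ-Fin 𝓩 f ≈ Σ-Fin 𝓩 g
  Σ-Fin-cong {f = f} {g} f≈g = begin
    Σ-Fin 𝓩 f ≡⟨ Σ-Fin≡sum f ⟩
    sum f     ≈⟨ sum-cong-≋ f≈g ⟩
    sum g     ≡⟨ Σ-Fin≡sum g ⟨
    Σ-Fin 𝓩 g ∎

  Σ-Fin-+ : ∀ {n} (f g : Fin n → Carrier) → Σ-Fin 𝓩 (λ i → f i + g i) ≈ Σ-Fin 𝓩 f + Σ-Fin 𝓩 g
  Σ-Fin-+ f g = begin
    Σ-Fin 𝓩 (λ i → f i + g i) ≡⟨ Σ-Fin≡sum (λ i → f i + g i) ⟩
    sum (λ i → f i + g i)     ≈⟨ ∑-distrib-+ f g ⟩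
    sum f + sum g             ≡⟨ ≡.cong₂ _+_ (Σ-Fin≡sum f) (Σ-Fin≡sum g) ⟨
    Σ-Fin 𝓩 f + Σ-Fin 𝓩 g     ∎

  *-distribʳ-Σ-Fin : ∀ {n} x (f : Fin n → Carrier) → Σ-Fin 𝓩 f * x ≈ Σ-Fin 𝓩 (λ i → f i * x)
  *-distribʳ-Σ-Fin x f = begin
    Σ-Fin 𝓩 f * x             ≡⟨ ≡.cong (_* x) (Σ-Fin≡sum f) ⟩
    sum f * x                 ≈⟨ *-distribʳ-sum x f ⟩
    sum (λ i → f i * x)       ≡⟨ Σ-Fin≡sum (λ i → f i * x) ⟨
    Σ-Fin 𝓩 (λ i → f i * x)   ∎

  Σ-Fin-comm : ∀ {m n} (f : Fin m → Fin n → Carrier) →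
    Σ-Fin 𝓩 (λ i → Σ-Fin 𝓩 (f i)) ≈ Σ-Fin 𝓩 (λ j → Σ-Fin 𝓩 (λ i → f i j))
  Σ-Fin-comm f = begin
    Σ-Fin 𝓩 (λ i → Σ-Fin 𝓩 (f i))           ≡⟨ nested f ⟩
    sum (λ i → sum (f i))                   ≈⟨ ∑-comm f ⟩
    sum (λ j → sum (λ i → f i j))           ≡⟨ nested (λ j i → f i j) ⟨
    Σ-Fin 𝓩 (λ j → Σ-Fin 𝓩 (λ i → f i j))   ∎
    where
    nested : ∀ {m n} (g : Fin m → Fin n → Carrier) → Σ-Fin 𝓩 (λ i → Σ-Fin 𝓩 (g i)) ≡ sum (λ i → sum (g i))
    nested g = ≡.trans (Σ-Fin≡sum (λ i → Σ-Fin 𝓩 (g i))) (sum-cong-≗ (Σ-Fin≡sum ∘ g))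

  Σ-Fin-const : ∀ n x → Σ-Fin 𝓩 {n} (λ _ → x) ≈ n × x
  Σ-Fin-const n x = trans (reflexive (Σ-Fin≡sum {n} _)) (sum-replicate n)

  Σ-Fin-0 : ∀ n → Σ-Fin 𝓩 {n} (λ _ → 0#) ≈ 0#
  Σ-Fin-0 n = trans (reflexive (Σ-Fin≡sum {n} _)) (sum-replicate-zero n)

  module _ {a} {A : Set a} where

    Σ-list-cong : ∀ (xs : List A) {f g : A → Carrier} → (∀ x → f x ≈ g x) → Σ-list 𝓩 xs f ≈ Σ-list 𝓩 xs g
    Σ-list-cong []       f≈g = refl
    Σ-list-cong (x ∷ xs) f≈g = +-cong (f≈g x) (Σ-list-cong xs f≈g)

    Σ-list-+ : ∀ (xs : List A) (f g : A → Carrier) →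
      Σ-list 𝓩 xs (λ x → f x + g x) ≈ Σ-list 𝓩 xs f + Σ-list 𝓩 xs g
    Σ-list-+ []       f g = sym (+-identityʳ 0#)
    Σ-list-+ (x ∷ xs) f g = trans (+-cong refl (Σ-list-+ xs f g)) (+-interchange (f x) (g x) _ _)

    *-distribˡ-Σ-list : ∀ (xs : List A) x (f : A → Carrier) → x * Σ-list 𝓩 xs f ≈ Σ-list 𝓩 xs (λ y → x * f y)
    *-distribˡ-Σ-list []       x f = zeroʳ x
    *-distribˡ-Σ-list (y ∷ xs) x f = trans (distribˡ x _ _) (+-cong refl (*-distribˡ-Σ-list xs x f))

    Σ-list-Σ-Fin : ∀ (xs : List A) {n} (f : A → Fin n → Carrier) →
      Σ-list 𝓩 xs (λ x → Σ-Fin 𝓩 (f x)) ≈ Σ-Fin 𝓩 (λ i → Σ-list 𝓩 xs (λ x → f x i))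
    Σ-list-Σ-Fin []       {n} f = sym (Σ-Fin-0 n)
    Σ-list-Σ-Fin (x ∷ xs)     f = trans (+-cong refl (Σ-list-Σ-Fin xs f)) (sym (Σ-Fin-+ (f x) _))

    Σ-list-++ : ∀ (xs ys : List A) f → Σ-list 𝓩 (xs ++ ys) f ≈ Σ-list 𝓩 xs f + Σ-list 𝓩 ys f
    Σ-list-++ []       ys f = sym (+-identityˡ _)
    Σ-list-++ (x ∷ xs) ys f = trans (+-cong refl (Σ-list-++ xs ys f)) (sym (+-assoc _ _ _))

    Σ-list-tabulate : ∀ {n} (h : Fin n → A) f → Σ-list 𝓩 (tabulate h) f ≈ Σ-Fin 𝓩 (f ∘ h)
    Σ-list-tabulate {zero}  h f = refl
    Σ-list-tabulate {suc n} h f = +-cong refl (Σ-list-tabulate (h ∘ suc) f)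

    Σ-list-filter : ∀ {p} {P : Pred A p} (P? : Decidable P) (xs : List A) f →
      Σ-list 𝓩 (filter P? xs) f ≈ Σ-list 𝓩 xs (λ x → if does (P? x) then f x else 0#)
    Σ-list-filter P? []       f = refl
    Σ-list-filter P? (x ∷ xs) f with does (P? x)
    ... | true  = +-cong refl (Σ-list-filter P? xs f)
    ... | false = trans (Σ-list-filter P? xs f) (sym (+-identityˡ _))

    Σ-list-filter-cong : ∀ {p} {P : Pred A p} (P? : Decidable P) (xs : List A) {f g : A → Carrier} →
      (∀ x → P x → f x ≈ g x) → Σ-list 𝓩 (filter P? xs) f ≈ Σ-list 𝓩 (filter P? xs) g
    Σ-list-filter-cong P? []       f≈g = refl
    Σ-list-filter-cong P? (x ∷ xs) f≈g with P? x
    ... | yes Px = +-cong (f≈g x Px) (Σ-list-filter-cong P? xs f≈g)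
    ... | no  _  = Σ-list-filter-cong P? xs f≈g

  module _ {a b} {A : Set a} {B : Set b} where

    Σ-list-map : ∀ (h : A → B) (xs : List A) f → Σ-list 𝓩 (map h xs) f ≈ Σ-list 𝓩 xs (f ∘ h)
    Σ-list-map h []       f = refl
    Σ-list-map h (x ∷ xs) f = +-cong refl (Σ-list-map h xs f)

    Σ-list-concatMap : ∀ (h : A → List B) (xs : List A) f →
      Σ-list 𝓩 (concatMap h xs) f ≈ Σ-list 𝓩 xs (λ x → Σ-list 𝓩 (h x) f)
    Σ-list-concatMap h []       f = refl
    Σ-list-concatMap h (x ∷ xs) f = trans (Σ-list-++ (h x) _ f) (+-cong refl (Σ-list-concatMap h xs f))

  if-cong : ∀ {b b'} {x y} → b ≡ b' → x ≈ y → (if b then x else 0#) ≈ (if b' then y else 0#)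
  if-cong {true}  ≡.refl x≈y = x≈y
  if-cong {false} ≡.refl x≈y = refl

  -- Sums over maps Fin n → Fin N; without function extensionality a summand has to respect
  -- pointwise equality of maps before it can be reindexed.

  Extensional : ∀ {n N} → ((Fin n → Fin N) → Carrier) → Set _
  Extensional g = ∀ {f f'} → f ≗ f' → g f ≈ g f'

  ∘-extensional : ∀ {n N} {g : (Fin n → Fin N) → Carrier} (σ : Fin n → Fin n) →
    Extensional g → Extensional (λ j → g (j ∘ σ))
  ∘-extensional σ g-ext f≗f' = g-ext (f≗f' ∘ σ)

  Σ-all : ∀ {n N} → ((Fin n → Fin N) → Carrier) → Carrier
  Σ-all {n} {N} = Σ-list 𝓩 (allMaps n N)

  module _ {N : ℕ} where

    Σ-all-cong : ∀ {n} {g g' : (Fin n → Fin N) → Carrier} → (∀ j → g j ≈ g' j) → Σ-all g ≈ Σ-all g'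
    Σ-all-cong {n} = Σ-list-cong (allMaps n N)

    Σ-all-suc : ∀ {n} (g : (Fin (suc n) → Fin N) → Carrier) →
      Σ-all g ≈ Σ-all (λ f → Σ-Fin 𝓩 (λ i → g (i ∷ᶠ f)))
    Σ-all-suc {n} g = trans (Σ-list-concatMap (λ f → map (_∷ᶠ f) (allFin N)) (allMaps n N) g) (Σ-all-cong {n} λ f →
      trans (Σ-list-map (_∷ᶠ f) (allFin N) g) (Σ-list-tabulate {n = N} id (λ i → g (i ∷ᶠ f))))

    -- (a+1 b+1) acts on the tail, (0 1) exchanges the two outermost sums, and
    -- (0 b+2) is the conjugate (1 b+2) ∘ (0 1) ∘ (1 b+2).
    Σ-all-transpose : ∀ {n} (a b : Fin n) {g : (Fin n → Fin N) → Carrier} → Extensional g →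
      Σ-all g ≈ Σ-all (λ j → g (j ∘ transpose a b))
    Σ-all-transpose-lift : ∀ {n} (a b : Fin n) {g : (Fin (suc n) → Fin N) → Carrier} → Extensional g →
      Σ-all g ≈ Σ-all (λ j → g (j ∘ transpose (suc a) (suc b)))
    Σ-all-transpose-01 : ∀ {n} {g : (Fin (suc (suc n)) → Fin N) → Carrier} → Extensional g →
      Σ-all g ≈ Σ-all (λ j → g (j ∘ transpose zero (suc zero)))
    Σ-all-transpose-0 : ∀ {n} (b : Fin n) {g : (Fin (suc n) → Fin N) → Carrier} → Extensional g →
      Σ-all g ≈ Σ-all (λ j → g (j ∘ transpose zero (suc b)))

    Σ-all-transpose zero    zero    g-ext = Σ-all-cong λ j → g-ext (≡.cong j ∘ ≡.sym ∘ transpose-self zero)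
    Σ-all-transpose zero    (suc b) g-ext = Σ-all-transpose-0 b g-ext
    Σ-all-transpose (suc a) zero    g-ext =
      trans (Σ-all-transpose-0 a g-ext) (Σ-all-cong λ j → g-ext (≡.cong j ∘ transpose-comm (suc a) zero))
    Σ-all-transpose (suc a) (suc b) g-ext = Σ-all-transpose-lift a b g-ext

    Σ-all-transpose-lift {n} a b {g} g-ext = begin
      Σ-all g                                               ≈⟨ Σ-all-suc g ⟩
      Σ-all (λ f → Σ-Fin 𝓩 (λ i → g (i ∷ᶠ f)))              ≈⟨ Σ-all-transpose a b tail-ext ⟩
      Σ-all (λ f → Σ-Fin 𝓩 (λ i → g (i ∷ᶠ (f ∘ τ))))        ≈⟨ Σ-all-cong lifted ⟩
      Σ-all (λ f → Σ-Fin 𝓩 (λ i → g ((i ∷ᶠ f) ∘ τ⁺)))       ≈⟨ Σ-all-suc (λ j → g (j ∘ τ⁺)) ⟨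
      Σ-all (λ j → g (j ∘ τ⁺))                              ∎
      where
      τ : Fin n → Fin n
      τ = transpose a b
      τ⁺ : Fin (suc n) → Fin (suc n)
      τ⁺ = transpose (suc a) (suc b)
      tail-ext : Extensional (λ f → Σ-Fin 𝓩 (λ i → g (i ∷ᶠ f)))
      tail-ext f≗f' = Σ-Fin-cong λ i → g-ext (∷ᶠ-cong i f≗f')
      lifted : ∀ f → Σ-Fin 𝓩 (λ i → g (i ∷ᶠ (f ∘ τ))) ≈ Σ-Fin 𝓩 (λ i → g ((i ∷ᶠ f) ∘ τ⁺))
      lifted f = Σ-Fin-cong λ i → g-ext (∷ᶠ-∘-transpose i f a b)

    Σ-all-transpose-01 {n} {g} g-ext = begin
      Σ-all g
        ≈⟨ Σ-all-suc g ⟩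
      Σ-all (λ f → Σ-Fin 𝓩 (λ i → g (i ∷ᶠ f)))
        ≈⟨ Σ-all-suc (λ f → Σ-Fin 𝓩 (λ i → g (i ∷ᶠ f))) ⟩
      Σ-all (λ h → Σ-Fin 𝓩 (λ k → Σ-Fin 𝓩 (λ i → g (i ∷ᶠ k ∷ᶠ h))))
        ≈⟨ Σ-all-cong (λ h → Σ-Fin-comm (λ k i → g (i ∷ᶠ k ∷ᶠ h))) ⟩
      Σ-all (λ h → Σ-Fin 𝓩 (λ i → Σ-Fin 𝓩 (λ k → g (i ∷ᶠ k ∷ᶠ h))))
        ≈⟨ Σ-all-cong (λ h → Σ-Fin-cong λ i → Σ-Fin-cong λ k → g-ext (∷ᶠ-∷ᶠ-transpose i k h)) ⟩
      Σ-all (λ h → Σ-Fin 𝓩 (λ i → Σ-Fin 𝓩 (λ k → g ((k ∷ᶠ i ∷ᶠ h) ∘ σ))))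
        ≈⟨ Σ-all-suc (λ f → Σ-Fin 𝓩 (λ k → g ((k ∷ᶠ f) ∘ σ))) ⟨
      Σ-all (λ f → Σ-Fin 𝓩 (λ k → g ((k ∷ᶠ f) ∘ σ)))
        ≈⟨ Σ-all-suc (λ j → g (j ∘ σ)) ⟨
      Σ-all (λ j → g (j ∘ σ))
        ∎
      where
      σ : Fin (suc (suc n)) → Fin (suc (suc n))
      σ = transpose zero (suc zero)

    Σ-all-transpose-0 zero    g-ext = Σ-all-transpose-01 g-ext
    Σ-all-transpose-0 {suc m} (suc b) {g} g-ext = begin
      Σ-all g                          ≈⟨ Σ-all-transpose-lift zero (suc b) g-ext ⟩
      Σ-all (λ j → g (j ∘ τ))          ≈⟨ Σ-all-transpose-01 (∘-extensional τ g-ext) ⟩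
      Σ-all (λ j → g (j ∘ σ ∘ τ))      ≈⟨ Σ-all-transpose-lift zero (suc b) (∘-extensional (σ ∘ τ) g-ext) ⟩
      Σ-all (λ j → g (j ∘ τ ∘ σ ∘ τ))  ≈⟨ Σ-all-cong (λ j → g-ext (≡.cong j ∘ conjugate)) ⟩
      Σ-all (λ j → g (j ∘ transpose zero (suc (suc b)))) ∎
      where
      σ τ : Fin (suc (suc m)) → Fin (suc (suc m))
      σ = transpose zero (suc zero)
      τ = transpose (suc zero) (suc (suc b))
      conjugate : τ ∘ σ ∘ τ ≗ transpose zero (suc (suc b))
      conjugate = transpose-conjugate (λ ()) (λ ()) (λ ())

    Σ-inj-cong : ∀ {n} {g g' : (Fin n → Fin N) → Carrier} → (∀ j → IsInjective j → g j ≈ g' j) →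
      Σ-inj 𝓩 g ≈ Σ-inj 𝓩 g'
    Σ-inj-cong {n} = Σ-list-filter-cong injective? (allMaps n N)

    Σ-inj-as-Σ-all : ∀ {n} (g : (Fin n → Fin N) → Carrier) →
      Σ-inj 𝓩 g ≈ Σ-all (λ j → if does (injective? j) then g j else 0#)
    Σ-inj-as-Σ-all {n} = Σ-list-filter injective? (allMaps n N)

    Σ-inj-transpose : ∀ {n} (a b : Fin n) {g : (Fin n → Fin N) → Carrier} → Extensional g →
      Σ-inj 𝓩 g ≈ Σ-inj 𝓩 (λ j → g (j ∘ transpose a b))
    Σ-inj-transpose {n} a b {g} g-ext = begin
      Σ-inj 𝓩 g                                                          ≈⟨ Σ-inj-as-Σ-all g ⟩
      Σ-all (λ j → if does (injective? j) then g j else 0#)              ≈⟨ Σ-all-transpose a b restricted-ext ⟩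
      Σ-all (λ j → if does (injective? (j ∘ τ)) then g (j ∘ τ) else 0#)
        ≈⟨ Σ-all-cong {n} (λ j → if-cong (τ-invariant j) refl) ⟩
      Σ-all (λ j → if does (injective? j) then g (j ∘ τ) else 0#)        ≈⟨ Σ-inj-as-Σ-all (λ j → g (j ∘ τ)) ⟨
      Σ-inj 𝓩 (λ j → g (j ∘ τ))                                          ∎
      where
      τ : Fin n → Fin n
      τ = transpose a b
      restricted-ext : Extensional (λ j → if does (injective? j) then g j else 0#)
      restricted-ext f≗f' = if-cong
        (does-⇔ (mk⇔ (injective-resp-≗ f≗f') (injective-resp-≗ (≡.sym ∘ f≗f'))) (injective? _) (injective? _))
        (g-ext f≗f')
      τ-invariant : ∀ j → does (injective? (j ∘ τ)) ≡ does (injective? j)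
      τ-invariant j = does-⇔ (injective-∘-involution τ (transpose-involutive a b) j) (injective? _) (injective? _)

    Σ-inj-suc : ∀ {n} (g : (Fin (suc n) → Fin N) → Carrier) →
      Σ-inj 𝓩 g ≈ Σ-inj 𝓩 (λ f → Σ-Fin 𝓩 (λ i → if does (fresh? i f) then g (i ∷ᶠ f) else 0#))
    Σ-inj-suc {n} g = begin
      Σ-inj 𝓩 g                                                        ≈⟨ Σ-inj-as-Σ-all g ⟩
      Σ-all (λ j → if does (injective? j) then g j else 0#)            ≈⟨ Σ-all-suc (λ j → if does (injective? j) then g j else 0#) ⟩
      Σ-all (λ f → Σ-Fin 𝓩 (λ i → if does (injective? (i ∷ᶠ f)) then g (i ∷ᶠ f) else 0#))
        ≈⟨ Σ-all-cong {n} (λ f → Σ-Fin-cong (λ i → if-cong (cons-injective? i f) refl)) ⟩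
      Σ-all (λ f → Σ-Fin 𝓩 (λ i → if does (injective? f) ∧ does (fresh? i f) then g (i ∷ᶠ f) else 0#))
        ≈⟨ Σ-all-cong {n} (λ f → pull-out (does (injective? f)) (λ i → does (fresh? i f)) (λ i → g (i ∷ᶠ f))) ⟩
      Σ-all (λ f → if does (injective? f) then Σ-Fin 𝓩 (λ i → if does (fresh? i f) then g (i ∷ᶠ f) else 0#) else 0#)
        ≈⟨ Σ-inj-as-Σ-all (λ f → Σ-Fin 𝓩 (λ i → if does (fresh? i f) then g (i ∷ᶠ f) else 0#)) ⟨
      Σ-inj 𝓩 (λ f → Σ-Fin 𝓩 (λ i → if does (fresh? i f) then g (i ∷ᶠ f) else 0#)) ∎
      where
      cons-injective? : ∀ i f → does (injective? (i ∷ᶠ f)) ≡ does (injective? f) ∧ does (fresh? i f)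
      cons-injective? i f = does-⇔ (injective-∷ i f) (injective? _) (injective? f ×-dec fresh? i f)
      pull-out : ∀ b (c : Fin N → Bool) (x : Fin N → Carrier) →
        Σ-Fin 𝓩 (λ i → if b ∧ c i then x i else 0#) ≈ (if b then Σ-Fin 𝓩 (λ i → if c i then x i else 0#) else 0#)
      pull-out true  c x = refl
      pull-out false c x = Σ-Fin-0 N

    image-indicator : ∀ {n} (f : Fin n → Fin N) → IsInjective f → ∀ k x →
      (if does (fresh? k f) then 0# else x) ≈ Σ-Fin 𝓩 (λ t → if does (f t ≟ k) then x else 0#)
    image-indicator {zero}  f inj k x = reflexive (≡.cong (λ b → if b then 0# else x) (dec-true (fresh? k f) λ ()))
    image-indicator {suc n} f inj k x = by-cases (f zero ≟ k)
      where
      tail-inj : IsInjective (f ∘ suc)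
      tail-inj x y fx≡fy = suc-injective (inj (suc x) (suc y) fx≡fy)
      tail-count : (if does (fresh? k (f ∘ suc)) then 0# else x) ≈ Σ-Fin 𝓩 (λ t → if does (f (suc t) ≟ k) then x else 0#)
      tail-count = image-indicator (f ∘ suc) tail-inj k x
      otherwise0 : ∀ {b b'} → b ≡ b' → (if b then 0# else x) ≈ (if b' then 0# else x)
      otherwise0 = reflexive ∘ ≡.cong (λ b → if b then 0# else x)
      by-cases : Dec (f zero ≡ k) →
        (if does (fresh? k f) then 0# else x) ≈ (if does (f zero ≟ k) then x else 0#) + Σ-Fin 𝓩 (λ t → if does (f (suc t) ≟ k) then x else 0#)
      by-cases (yes f0≡k) = begin
        (if does (fresh? k f) then 0# else x)   ≈⟨ otherwise0 (dec-false (fresh? k f) (λ fresh → fresh zero f0≡k)) ⟩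
        x                                       ≈⟨ +-identityʳ x ⟨
        x + 0#                                  ≈⟨ +-cong (if-cong (≡.sym (dec-true (f zero ≟ k) f0≡k)) refl) tail-zero ⟩
        (if does (f zero ≟ k) then x else 0#) + Σ-Fin 𝓩 (λ t → if does (f (suc t) ≟ k) then x else 0#) ∎
        where
        tail-fresh : Fresh k (f ∘ suc)
        tail-fresh t ft≡k = 0≢1+n (inj zero (suc t) (≡.trans f0≡k (≡.sym ft≡k)))
        tail-zero : 0# ≈ Σ-Fin 𝓩 (λ t → if does (f (suc t) ≟ k) then x else 0#)
        tail-zero = trans (otherwise0 (≡.sym (dec-true (fresh? k (f ∘ suc)) tail-fresh))) tail-count
      by-cases (no f0≢k) = begin
        (if does (fresh? k f) then 0# else x)           ≈⟨ otherwise0 (does-⇔ fresh-⇔ (fresh? k f) (fresh? k (f ∘ suc))) ⟩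
        (if does (fresh? k (f ∘ suc)) then 0# else x)   ≈⟨ tail-count ⟩
        Σ-Fin 𝓩 (λ t → if does (f (suc t) ≟ k) then x else 0#) ≈⟨ +-identityˡ _ ⟨
        0# + Σ-Fin 𝓩 (λ t → if does (f (suc t) ≟ k) then x else 0#)
          ≈⟨ +-cong (if-cong (≡.sym (dec-false (f zero ≟ k) f0≢k)) refl) refl ⟩
        (if does (f zero ≟ k) then x else 0#) + Σ-Fin 𝓩 (λ t → if does (f (suc t) ≟ k) then x else 0#) ∎
        where
        fresh-⇔ : Fresh k f ⇔ Fresh k (f ∘ suc)
        fresh-⇔ = mk⇔ (λ fresh → fresh ∘ suc) λ where
          fresh zero    → f0≢k
          fresh (suc t) → fresh t

    Σ-Fin-δ : ∀ {M} (a : Fin M) (h : Fin M → Carrier) → Σ-Fin 𝓩 (λ k → if does (a ≟ k) then h k else 0#) ≈ h a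
    Σ-Fin-δ {suc M} zero    h = trans (+-cong refl (Σ-Fin-0 M)) (+-identityʳ _)
    Σ-Fin-δ {suc M} (suc a) h = trans (+-identityˡ _) (Σ-Fin-δ a (h ∘ suc))

    Σ-Fin-image : ∀ {n} (f : Fin n → Fin N) → IsInjective f → (h : Fin N → Carrier) →
      Σ-Fin 𝓩 h ≈ Σ-Fin 𝓩 (h ∘ f) + Σ-Fin 𝓩 (λ k → if does (fresh? k f) then h k else 0#)
    Σ-Fin-image {n} f inj h = begin
      Σ-Fin 𝓩 h                                                    ≈⟨ Σ-Fin-cong (λ k → split (does (fresh? k f))) ⟩
      Σ-Fin 𝓩 (λ k → (if does (fresh? k f) then 0# else h k) + (if does (fresh? k f) then h k else 0#))
        ≈⟨ Σ-Fin-+ {N} _ _ ⟩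
      Σ-Fin 𝓩 (λ k → if does (fresh? k f) then 0# else h k) + Σ-Fin 𝓩 (λ k → if does (fresh? k f) then h k else 0#)
        ≈⟨ +-cong image refl ⟩
      Σ-Fin 𝓩 (h ∘ f) + Σ-Fin 𝓩 (λ k → if does (fresh? k f) then h k else 0#) ∎
      where
      split : ∀ {k} b → h k ≈ (if b then 0# else h k) + (if b then h k else 0#)
      split true  = sym (+-identityˡ _)
      split false = sym (+-identityʳ _)
      image : Σ-Fin 𝓩 (λ k → if does (fresh? k f) then 0# else h k) ≈ Σ-Fin 𝓩 (h ∘ f)
      image = begin
        Σ-Fin 𝓩 (λ k → if does (fresh? k f) then 0# else h k)  ≈⟨ Σ-Fin-cong (λ k → image-indicator f inj k (h k)) ⟩
        Σ-Fin 𝓩 (λ k → Σ-Fin 𝓩 (occurrence k))                 ≈⟨ Σ-Fin-comm occurrence ⟩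
        Σ-Fin 𝓩 (λ t → Σ-Fin 𝓩 (λ k → occurrence k t))         ≈⟨ Σ-Fin-cong (λ t → Σ-Fin-δ (f t) h) ⟩
        Σ-Fin 𝓩 (h ∘ f)                                        ∎
        where
        occurrence : Fin N → Fin n → Carrier
        occurrence k t = if does (f t ≟ k) then h k else 0#

    Σ-inj-extensions : ∀ {n} (g : (Fin n → Fin N) → Carrier) →
      n × Σ-inj 𝓩 g + Σ-inj 𝓩 (λ j → g (j ∘ suc)) ≈ N × Σ-inj 𝓩 g
    Σ-inj-extensions {n} g = begin
      n × Σ-inj 𝓩 g + Σ-inj 𝓩 (λ j → g (j ∘ suc))
        ≈⟨ +-cong (sym (Σ-Fin-const n _)) (Σ-inj-suc (λ j → g (j ∘ suc))) ⟩
      Σ-Fin 𝓩 {n} (λ _ → Σ-inj 𝓩 g) + Σ-inj 𝓩 (λ f → Σ-Fin 𝓩 (λ i → if does (fresh? i f) then g f else 0#))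
        ≈⟨ +-cong (sym (Σ-list-Σ-Fin (injMaps n N) {n} (λ f _ → g f))) refl ⟩
      Σ-inj 𝓩 (λ f → Σ-Fin 𝓩 {n} (λ _ → g f)) + Σ-inj 𝓩 (λ f → Σ-Fin 𝓩 (λ i → if does (fresh? i f) then g f else 0#))
        ≈⟨ Σ-list-+ (injMaps n N) _ _ ⟨
      Σ-inj 𝓩 (λ f → Σ-Fin 𝓩 {n} (λ _ → g f) + Σ-Fin 𝓩 (λ i → if does (fresh? i f) then g f else 0#))
        ≈⟨ Σ-inj-cong (λ f inj → sym (Σ-Fin-image f inj (λ _ → g f))) ⟩
      Σ-inj 𝓩 (λ f → Σ-Fin 𝓩 {N} (λ _ → g f))  ≈⟨ Σ-list-Σ-Fin (injMaps n N) {N} (λ f _ → g f) ⟩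
      Σ-Fin 𝓩 {N} (λ _ → Σ-inj 𝓩 g)              ≈⟨ Σ-Fin-const N _ ⟩
      N × Σ-inj 𝓩 g                              ∎

  -- Sums and products over subsets

  Σ-sub-cong : ∀ {n} (S : Subset n) {f g : Fin n → Carrier} → (∀ s → s ∈ S → f s ≈ g s) → Σ-sub 𝓩 S f ≈ Σ-sub 𝓩 S g
  Σ-sub-cong S {f} {g} f≈g = Σ-Fin-cong guarded
    where
    guarded : ∀ s → (if lookup S s then f s else 0#) ≈ (if lookup S s then g s else 0#)
    guarded s with lookup S s in s∈S
    ... | true  = f≈g s (lookup⇒[]= s S s∈S)
    ... | false = refl

  Σ-sub-+ : ∀ {n} (S : Subset n) (f g : Fin n → Carrier) → Σ-sub 𝓩 S (λ s → f s + g s) ≈ Σ-sub 𝓩 S f + Σ-sub 𝓩 S g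
  Σ-sub-+ {n} S f g = trans (Σ-Fin-cong λ s → guarded-+ (lookup S s)) (Σ-Fin-+ {n} _ _)
    where
    guarded-+ : ∀ b {x y} → (if b then x + y else 0#) ≈ (if b then x else 0#) + (if b then y else 0#)
    guarded-+ true  = refl
    guarded-+ false = sym (+-identityˡ 0#)

  Σ-sub-∁ : ∀ {n} (S : Subset n) (f : Fin n → Carrier) → Σ-sub 𝓩 S f + Σ-sub 𝓩 (∁ S) f ≈ Σ-Fin 𝓩 f
  Σ-sub-∁ {n} S f = trans (sym (Σ-Fin-+ {n} _ _)) (Σ-Fin-cong λ s →
    trans (+-cong refl (reflexive (≡.cong (λ b → if b then f s else 0#) (lookup-map s not S)))) (complementary (lookup S s)))
    where
    complementary : ∀ b {x} → (if b then x else 0#) + (if not b then x else 0#) ≈ x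
    complementary true  = +-identityʳ _
    complementary false = +-identityˡ _

  Π-sub-cong : ∀ {n} (S : Subset n) {f g : Fin n → Carrier} → (∀ l → l ∈ S → f l ≈ g l) → Π-sub 𝓩 S f ≈ Π-sub 𝓩 S g
  Π-sub-cong []          f≈g = refl
  Π-sub-cong (true  ∷ S) f≈g = *-cong (f≈g zero here) (Π-sub-cong S λ l l∈S → f≈g (suc l) (there l∈S))
  Π-sub-cong (false ∷ S) f≈g = *-cong refl (Π-sub-cong S λ l l∈S → f≈g (suc l) (there l∈S))

  Π-sub-∪-⁅⁆ : ∀ {n} (S : Subset n) {r} (f : Fin n → Carrier) → r ∉ S → Π-sub 𝓩 (S ∪ ⁅ r ⁆) f ≈ f r * Π-sub 𝓩 S f
  Π-sub-∪-⁅⁆ (true  ∷ S) {zero}  f r∉S = ⊥-elim (r∉S here)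
  Π-sub-∪-⁅⁆ (false ∷ S) {zero}  f r∉S =
    *-cong refl (trans (reflexive (≡.cong (λ T → Π-sub 𝓩 T (f ∘ suc)) (∪-identityʳ S))) (sym (*-identityˡ _)))
  Π-sub-∪-⁅⁆ (true  ∷ S) {suc r} f r∉S =
    trans (*-cong refl (Π-sub-∪-⁅⁆ S (f ∘ suc) (r∉S ∘ there))) (x*yz≈y*xz _ _ _)
  Π-sub-∪-⁅⁆ (false ∷ S) {suc r} f r∉S =
    trans (*-cong refl (Π-sub-∪-⁅⁆ S (f ∘ suc) (r∉S ∘ there))) (x*yz≈y*xz _ _ _)

  Π-sub-remove : ∀ {n} (S : Subset n) {s} (f : Fin n → Carrier) → s ∈ S → Π-sub 𝓩 S f ≈ f s * Π-sub 𝓩 (S Sub.- s) f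
  Π-sub-remove (true ∷ S) {zero}  f here =
    *-cong refl (trans (reflexive (≡.cong (λ T → Π-sub 𝓩 T (f ∘ suc)) (≡.sym (p─⊥≡p S)))) (sym (*-identityˡ _)))
  Π-sub-remove (b    ∷ S) {suc s} f (there s∈S) =
    trans (*-cong refl (Π-sub-remove S (f ∘ suc) s∈S)) (x*yz≈y*xz _ _ _)

  ∉-minus-self : ∀ {n} (S : Subset n) s → s ∉ S Sub.- s
  ∉-minus-self (b ∷ S) zero    ()
  ∉-minus-self (b ∷ S) (suc s) (there s∈S-s) = ∉-minus-self S s s∈S-s

  cancel-halves : ∀ {x c d P A M B T} → c * M ≈ x → d + d ≈ c →
    P + B ≈ A + M → T + (B + B) ≈ A + A → x - c * P ≈ - (d * T)
  cancel-halves {x} {c} {d} {P} {A} {M} {B} {T} cM≈x d+d≈c P+B≈A+M T+2B≈2A = begin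
    x - c * P                                                 ≈⟨ +-cong (trans (sym cM≈x) (*-cong (sym d+d≈c) refl))
                                                                         (-‿cong (*-cong (sym d+d≈c) (subtracted P+B≈A+M))) ⟩
    (d + d) * M - (d + d) * ((A + M) - B)                     ≈⟨ expanded d M A B ⟩
    - (d * ((A + A) - (B + B)))                               ≈⟨ -‿cong (*-cong refl (subtracted T+2B≈2A)) ⟨
    - (d * T)                                                 ∎
    where
    subtracted : ∀ {a b e} → a + b ≈ e → a ≈ e - b
    subtracted {a} {b} a+b≈e = trans (solve 2 (λ a b → a := a :+ b :- b) refl a b) (+-cong a+b≈e refl)
    expanded : ∀ d M A B → (d + d) * M - (d + d) * ((A + M) - B) ≈ - (d * ((A + A) - (B + B)))
    expanded = solve 4 (λ d M A B → (d :+ d) :* M :- (d :+ d) :* ((A :+ M) :- B)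
                                    := :- (d :* ((A :+ A) :- (B :+ B)))) refl

  module _ {N n : ℕ} (Z : Fin N → Fin n → Carrier) where

    p-extensional : ∀ S → Extensional (λ j → p 𝓩 Z j S)
    p-extensional S j≗j' = Π-sub-cong S λ l _ → reflexive (≡.cong (λ k → Z k l) (j≗j' l))

    Z-extensional : ∀ (t u : Fin n) → Extensional (λ j → Z (j t) u)
    Z-extensional t u j≗j' = reflexive (≡.cong (λ k → Z k u) (j≗j' t))

    p-transpose : ∀ S {a b} → a ∉ S → b ∉ S → ∀ j → p 𝓩 Z (j ∘ transpose a b) S ≈ p 𝓩 Z j S
    p-transpose S {a} {b} a∉S b∉S j = Π-sub-cong S λ l l∈S → reflexive (≡.cong (λ k → Z (j k) l)
      (transpose-other a b (λ l≡a → a∉S (≡.subst (_∈ S) l≡a l∈S)) (λ l≡b → b∉S (≡.subst (_∈ S) l≡b l∈S))))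

    module _ (R : Subset n) (r : Fin n) (r∉R : r ∉ R) where

      w̄ : Fin n → Carrier
      w̄ t = Σ-inj 𝓩 (λ j → Z (j t) r * p 𝓩 Z j R)

      term-extensional : ∀ t → Extensional (λ j → Z (j t) r * p 𝓩 Z j R)
      term-extensional t j≗j' = *-cong (Z-extensional t r j≗j') (p-extensional R j≗j')

      p̄-∪-⁅⁆ : p̄ 𝓩 Z (R ∪ ⁅ r ⁆) ≈ w̄ r
      p̄-∪-⁅⁆ = Σ-list-cong (injMaps n N) λ j → Π-sub-∪-⁅⁆ R (λ l → Z (j l) l) r∉R

      w̄-outside : ∀ {t} → t ∉ R → w̄ t ≈ w̄ r
      w̄-outside {t} t∉R = trans (Σ-inj-transpose t r (term-extensional t)) (Σ-list-cong (injMaps n N) λ j →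
        *-cong (reflexive (≡.cong (λ k → Z (j k) r) (transpose-matchˡ t r))) (p-transpose R t∉R r∉R j))

      fresh-part : Carrier
      fresh-part = Σ-inj 𝓩 (λ j → Σ-Fin 𝓩 (λ k → if does (fresh? k j) then Z k r * p 𝓩 Z j R else 0#))

      Σz-p̄ : Σ-Fin 𝓩 (λ k → Z k r) * p̄ 𝓩 Z R ≈ Σ-Fin 𝓩 w̄ + fresh-part
      Σz-p̄ = begin
        Σ-Fin 𝓩 (λ k → Z k r) * p̄ 𝓩 Z R
          ≈⟨ *-distribˡ-Σ-list (injMaps n N) _ _ ⟩
        Σ-inj 𝓩 (λ j → Σ-Fin 𝓩 (λ k → Z k r) * p 𝓩 Z j R)
          ≈⟨ Σ-list-cong (injMaps n N) (λ j → *-distribʳ-Σ-Fin (p 𝓩 Z j R) (λ k → Z k r)) ⟩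
        Σ-inj 𝓩 (λ j → Σ-Fin 𝓩 (λ k → Z k r * p 𝓩 Z j R))
          ≈⟨ Σ-inj-cong (λ j inj → Σ-Fin-image j inj (λ k → Z k r * p 𝓩 Z j R)) ⟩
        Σ-inj 𝓩 (λ j → Σ-Fin 𝓩 (λ t → Z (j t) r * p 𝓩 Z j R) + Σ-Fin 𝓩 (λ k → if does (fresh? k j) then Z k r * p 𝓩 Z j R else 0#))
          ≈⟨ Σ-list-+ (injMaps n N) _ _ ⟩
        Σ-inj 𝓩 (λ j → Σ-Fin 𝓩 (λ t → Z (j t) r * p 𝓩 Z j R)) + fresh-part
          ≈⟨ +-cong (Σ-list-Σ-Fin (injMaps n N) (λ j t → Z (j t) r * p 𝓩 Z j R)) refl ⟩
        Σ-Fin 𝓩 w̄ + fresh-part ∎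

      fresh-part-count : n × w̄ r + fresh-part ≈ N × w̄ r
      fresh-part-count = trans (+-cong refl fresh-part≈) (Σ-inj-extensions (λ j → Z (j r) r * p 𝓩 Z j R))
        where
        τ : Fin (suc n) → Fin (suc n)
        τ = transpose zero (suc r)
        head-term : (Fin (suc n) → Fin N) → Carrier
        head-term j = Z (j zero) r * p 𝓩 Z (j ∘ suc) R
        head-term-extensional : Extensional head-term
        head-term-extensional j≗j' =
          *-cong (reflexive (≡.cong (λ k → Z k r) (j≗j' zero))) (p-extensional R (j≗j' ∘ suc))
        τ-fixes-R : ∀ j → p 𝓩 Z (j ∘ τ ∘ suc) R ≈ p 𝓩 Z (j ∘ suc) R
        τ-fixes-R j = Π-sub-cong R λ l l∈R → reflexive (≡.cong (λ k → Z (j k) l)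
          (transpose-other zero (suc r) (λ ()) (λ l≡r → r∉R (≡.subst (_∈ R) (suc-injective l≡r) l∈R))))
        relabelled : ∀ j → head-term (j ∘ τ) ≈ Z (j (suc r)) r * p 𝓩 Z (j ∘ suc) R
        relabelled j = *-cong (reflexive (≡.cong (λ k → Z (j k) r) (transpose-matchˡ zero (suc r)))) (τ-fixes-R j)
        fresh-part≈ : fresh-part ≈ Σ-inj 𝓩 (λ j → Z (j (suc r)) r * p 𝓩 Z (j ∘ suc) R)
        fresh-part≈ = begin
          fresh-part                                       ≈⟨ Σ-inj-suc head-term ⟨
          Σ-inj 𝓩 head-term                                ≈⟨ Σ-inj-transpose zero (suc r) head-term-extensional ⟩
          Σ-inj 𝓩 (λ j → head-term (j ∘ τ))                ≈⟨ Σ-list-cong (injMaps (suc n) N) relabelled ⟩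
          Σ-inj 𝓩 (λ j → Z (j (suc r)) r * p 𝓩 Z (j ∘ suc) R) ∎

      zz-term : Fin n → Fin n → Fin n → (Fin n → Fin N) → Carrier
      zz-term s a b j = Z (j a) r * Z (j b) s * p 𝓩 Z j (R Sub.- s)

      Σ-zz-term-relabel : ∀ {s a b a' b'} → transpose r s a ≡ a' → transpose r s b ≡ b' →
        Σ-inj 𝓩 (zz-term s a b) ≈ Σ-inj 𝓩 (zz-term s a' b')
      Σ-zz-term-relabel {s} {a} {b} {a'} {b'} τa≡a' τb≡b' = begin
        Σ-inj 𝓩 (zz-term s a b)                              ≈⟨ Σ-inj-transpose r s zz-extensional ⟩
        Σ-inj 𝓩 (λ j → zz-term s a b (j ∘ transpose r s))
          ≈⟨ Σ-list-cong (injMaps n N) (λ j → *-cong refl (p-transpose R-s r∉R-s s∉R-s j)) ⟩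
        Σ-inj 𝓩 (zz-term s (transpose r s a) (transpose r s b)) ≡⟨ ≡.cong₂ (λ a b → Σ-inj 𝓩 (zz-term s a b)) τa≡a' τb≡b' ⟩
        Σ-inj 𝓩 (zz-term s a' b')                            ∎
        where
        R-s : Subset n
        R-s = R Sub.- s
        r∉R-s : r ∉ R-s
        r∉R-s = r∉R ∘ p─q⊆p R ⁅ s ⁆
        s∉R-s : s ∉ R-s
        s∉R-s = ∉-minus-self R s
        zz-extensional : Extensional (zz-term s a b)
        zz-extensional j≗j' = *-cong (*-cong (Z-extensional a r j≗j') (Z-extensional b s j≗j')) (p-extensional R-s j≗j')

      Σ-zz-term-w̄ : ∀ {s} → s ∈ R → ∀ t → Σ-inj 𝓩 (zz-term s t s) ≈ w̄ t
      Σ-zz-term-w̄ s∈R t = Σ-list-cong (injMaps n N) λ j →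
        trans (*-assoc _ _ _) (*-cong refl (sym (Π-sub-remove R (λ l → Z (j l) l) s∈R)))

      yy-term : Fin n → (Fin n → Fin N) → Carrier
      yy-term s j = y 𝓩 Z (j r) (j s) r * y 𝓩 Z (j r) (j s) s * p 𝓩 Z j (R Sub.- s)

      Σ-inj-yy-term : ∀ {s} → s ∈ R → Σ-inj 𝓩 (yy-term s) + (w̄ r + w̄ r) ≈ w̄ s + w̄ s
      Σ-inj-yy-term {s} s∈R = begin
        Σ-inj 𝓩 (yy-term s) + (w̄ r + w̄ r)
          ≈⟨ +-cong refl (+-cong (sym (Σ-zz-term-w̄ s∈R r)) (sym sr≈w̄r)) ⟩
        Σ-inj 𝓩 (yy-term s) + (Σ-inj 𝓩 (zz-term s r s) + Σ-inj 𝓩 (zz-term s s r))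
          ≈⟨ +-cong refl (Σ-list-+ (injMaps n N) _ _) ⟨
        Σ-inj 𝓩 (yy-term s) + Σ-inj 𝓩 (λ j → zz-term s r s j + zz-term s s r j)
          ≈⟨ Σ-list-+ (injMaps n N) _ _ ⟨
        Σ-inj 𝓩 (λ j → yy-term s j + (zz-term s r s j + zz-term s s r j))
          ≈⟨ Σ-list-cong (injMaps n N) (λ j → expand _ _ _ _ _) ⟩
        Σ-inj 𝓩 (λ j → zz-term s r r j + zz-term s s s j)
          ≈⟨ Σ-list-+ (injMaps n N) _ _ ⟩
        Σ-inj 𝓩 (zz-term s r r) + Σ-inj 𝓩 (zz-term s s s)
          ≈⟨ +-cong rr≈w̄s (Σ-zz-term-w̄ s∈R s) ⟩
        w̄ s + w̄ s ∎
        where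
        expand : ∀ a b c d e → (a - b) * (c - d) * e + (a * d * e + b * c * e) ≈ a * c * e + b * d * e
        expand = solve 5 (λ a b c d e → (a :- b) :* (c :- d) :* e :+ (a :* d :* e :+ b :* c :* e)
                                        := a :* c :* e :+ b :* d :* e) refl
        sr≈w̄r : Σ-inj 𝓩 (zz-term s s r) ≈ w̄ r
        sr≈w̄r = trans (Σ-zz-term-relabel (transpose-matchʳ r s) (transpose-matchˡ r s)) (Σ-zz-term-w̄ s∈R r)
        rr≈w̄s : Σ-inj 𝓩 (zz-term s r r) ≈ w̄ s
        rr≈w̄s = trans (Σ-zz-term-relabel (transpose-matchˡ r s) (transpose-matchˡ r s)) (Σ-zz-term-w̄ s∈R s)

      Σz-p̄-count : Σ-Fin 𝓩 (λ k → Z k r) * p̄ 𝓩 Z R + Σ-sub 𝓩 R (λ _ → w̄ r) ≈ Σ-sub 𝓩 R w̄ + N × w̄ r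
      Σz-p̄-count = begin
        Σ-Fin 𝓩 (λ k → Z k r) * p̄ 𝓩 Z R + RX        ≈⟨ +-cong Σz-p̄ refl ⟩
        (Σ-Fin 𝓩 w̄ + fresh-part) + RX                ≈⟨ +-cong (+-cong (sym (Σ-sub-∁ R w̄)) refl) refl ⟩
        ((A + Σ-sub 𝓩 (∁ R) w̄) + fresh-part) + RX    ≈⟨ +-cong (+-cong (+-cong refl outside) refl) refl ⟩
        ((A + B) + fresh-part) + RX                  ≈⟨ regroup A B fresh-part RX ⟩
        A + ((RX + B) + fresh-part)                  ≈⟨ +-cong refl (+-cong (trans (Σ-sub-∁ R _) (Σ-Fin-const n _)) refl) ⟩
        A + (n × w̄ r + fresh-part)                   ≈⟨ +-cong refl fresh-part-count ⟩
        A + N × w̄ r                                  ∎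
        where
        A B RX : Carrier
        A  = Σ-sub 𝓩 R w̄
        B  = Σ-sub 𝓩 (∁ R) (λ _ → w̄ r)
        RX = Σ-sub 𝓩 R (λ _ → w̄ r)
        outside : Σ-sub 𝓩 (∁ R) w̄ ≈ B
        outside = Σ-sub-cong (∁ R) λ t t∈∁R → w̄-outside (x∈∁p⇒x∉p t∈∁R)
        regroup : ∀ a b f x → ((a + b) + f) + x ≈ a + ((x + b) + f)
        regroup = solve 4 (λ a b f x → ((a :+ b) :+ f) :+ x := a :+ ((x :+ b) :+ f)) refl

      Σ-yy-term : Σ-sub 𝓩 R (λ s → Σ-inj 𝓩 (yy-term s)) + (Σ-sub 𝓩 R (λ _ → w̄ r) + Σ-sub 𝓩 R (λ _ → w̄ r))
                    ≈ Σ-sub 𝓩 R w̄ + Σ-sub 𝓩 R w̄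
      Σ-yy-term = begin
        Σ-sub 𝓩 R (λ s → Σ-inj 𝓩 (yy-term s)) + (Σ-sub 𝓩 R (λ _ → w̄ r) + Σ-sub 𝓩 R (λ _ → w̄ r))
          ≈⟨ +-cong refl (Σ-sub-+ R _ _) ⟨
        Σ-sub 𝓩 R (λ s → Σ-inj 𝓩 (yy-term s)) + Σ-sub 𝓩 R (λ _ → w̄ r + w̄ r)
          ≈⟨ Σ-sub-+ R _ _ ⟨
        Σ-sub 𝓩 R (λ s → Σ-inj 𝓩 (yy-term s) + (w̄ r + w̄ r))
          ≈⟨ Σ-sub-cong R (λ s s∈R → Σ-inj-yy-term s∈R) ⟩
        Σ-sub 𝓩 R (λ s → w̄ s + w̄ s)
          ≈⟨ Σ-sub-+ R w̄ w̄ ⟩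
        Σ-sub 𝓩 R w̄ + Σ-sub 𝓩 R w̄ ∎

      insertion-identity : ∀ {k} → N ≡ suc k →
        p̄ 𝓩 Z (R ∪ ⁅ r ⁆) - z̃ 𝓩 Z r * p̄ 𝓩 Z R ≈ - (ι (recip (2 ℕ.* N)) * Σ-sub 𝓩 R (λ s → Σ-inj 𝓩 (yy-term s)))
      insertion-identity {k} ≡.refl = begin
        p̄ 𝓩 Z (R ∪ ⁅ r ⁆) - z̃ 𝓩 Z r * p̄ 𝓩 Z R
          ≈⟨ +-cong p̄-∪-⁅⁆ (-‿cong (*-assoc _ _ _)) ⟩
        w̄ r - ι (recip N) * (Σ-Fin 𝓩 (λ k → Z k r) * p̄ 𝓩 Z R)
          ≈⟨ cancel-halves (recip-×-cancel k (w̄ r)) (recip-double k) Σz-p̄-count Σ-yy-term ⟩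
        - (ι (recip (2 ℕ.* N)) * Σ-sub 𝓩 R (λ s → Σ-inj 𝓩 (yy-term s))) ∎

corollary3p5 : ∀ {c ℓ} (𝓩 : QAlgebra c ℓ) (N n : ℕ) → 1 ≤ n → n ≤ N →
    (Z : Fin N → Fin n → QAlgebra.Carrier 𝓩) (R : Subset n) (r : Fin n) → r ∉ R →
    let open QAlgebra 𝓩 in
    p̄ 𝓩 Z (R ∪ ⁅ r ⁆) - z̃ 𝓩 Z r * p̄ 𝓩 Z R
      ≈ - (ι (recip (2 ℕ.* N)) *
            Σ-sub 𝓩 R (λ s → Σ-inj 𝓩 (λ j →
              y 𝓩 Z (j r) (j s) r * y 𝓩 Z (j r) (j s) s * p 𝓩 Z j (R Sub.- s))))
-- The hypotheses 1 ≤ n ≤ N only exclude N = 0, where the junk value recip 0 = 0 breaks z̃.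
corollary3p5 𝓩 zero    n 1≤n n≤0 Z R r r∉R with () ← ℕP.≤-trans 1≤n n≤0
corollary3p5 𝓩 (suc k) n _   _   Z R r r∉R = insertion-identity 𝓩 Z R r r∉R ≡.refl
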